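{- Let $P$ be a valid PBP of $T$ with following position $i$, let $j\in\{1,\dots,n\}$ and $\ell\in\{0,\dots,\mathsf{lcp}(i,j)-1\}$, let $Q=P\cdot\langle j,\ell\rangle$ (where $P\cdot\langle j,0\rangle$ means $P$) be a valid PBP, and let $Q'=P\cdot\langle j,\ell+1\rangle$. For a valid PBP $R$, let $\mathcal{D}_R$ be the partition of $\{1,\dots,n\}$ into classes of positions having the same source in $R$. Then: (1) if $i+\ell$ and $j+\ell$ lie in different classes of $\mathcal{D}_Q$, then $Q'$ is valid; otherwise $Q'$ is invalid. (2) If $Q'$ is valid, $\mathcal{D}_{Q'}$ equals the partition obtained from $\mathcal{D}_Q$ by merging the classes containing $i+\ell$ and $j+\ell$.
   Context: Let $T=T[1]\cdots T[n]$ be a string over an ordered alphabet $\Sigma$ (elements regarded as distinct from integers); $\mathsf{lcp}(a,b)$ is the length of the longest common prefix of $T[a..n]$ and $T[b..n]$. A partial bidirectional parse (PBP) of $T$ is a sequence of phrases $f_1,\dots,f_k$ partitioning a prefix $T[1..m]$, with $f_x=T[s_x..s_x+|f_x|-1]$, $s_1=1$, $s_{x+1}=s_x+|f_x|$; each phrase is a character phrase ($|f_x|=1$, storing $T[s_x]$) or a target phrase $\langle t_x,|f_x|\rangle$ with $t_x\in\{1,\dots,n\}$, $t_x\ne s_x$, $t_x+|f_x|-1\le n$, $T[t_x..t_x+|f_x|-1]=T[s_x..s_x+|f_x|-1]$. The position following $P$ is $i=m+1$. $B_P$ is $P$ followed by character phrases $T[m+1],\dots,T[n]$. For $B_P$ define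 $g^0(x)=T[x]$ if $x$ lies in a character phrase and $g^0(x)=t_p+(x-s_p)$ if $x$ lies in target phrase $f_p$; $g^k(x)=g^{k-1}(x)$ if $g^{k-1}(x)\in\Sigma$, else $g^k(x)=g^0(g^{k-1}(x))$. $P$ is valid if $g^n(x)\in\Sigma$ for all $x$. $P\cdot f$ denotes appending phrase $f$. For a valid PBP $P$ and position $x$, the source $\mathit{source}(P,x)$ is the position $y$ such that either $g^0(x)\in\Sigma$ and $y=x$, or $g^k(x)=y$ and $g^{k+1}(x)\in\Sigma$ for some $k\ge0$ (computed in $B_P$). -}

module Defs where

open import Data.Nat using (ℕ; zero; suc; _+_; _∸_; _≤_; _<_; _≟_; _<?_)
open import Data.Nat.Properties using ()
open import Data.List using (List; []; _∷_; _++_; [_]; map)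
open import Data.Nat.ListAction using (sum)
open import Data.Vec using (Vec; []; _∷_)
open import Data.Maybe using (Maybe; just; nothing)
open import Data.Sum using (_⊎_; inj₁; inj₂)
open import Data.Product using (_×_; ∃; ∃-syntax; Σ-syntax)
open import Relation.Binary.PropositionalEquality using (_≡_; _≢_)
open import Relation.Binary.Definitions using (DecidableEquality)
open import Relation.Nullary using (yes; no)

-- Phrases of a (partial) bidirectional parse.
--   chr c     : a character phrase storing the character c (length 1)
--   tgt t len : a target phrase ⟨t, len⟩
data Phrase (A : Set) : Set where
  chr : A → Phrase A
  tgt : ℕ → ℕ → Phrase A

len : {A : Set} → Phrase A → ℕ
len (chr _)   = 1
len (tgt _ l) = l

_!_ : {A : Set} {m : ℕ} → Vec A m → ℕ → Maybe A
[] ! _ = nothing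
(a ∷ v) ! zero = just a
(a ∷ v) ! suc k = v ! k

IsChar : {A : Set} → A ⊎ ℕ → Set
IsChar {A} v = Σ[ c ∈ A ] v ≡ inj₁ c

module _ {A : Set} {n : ℕ} (T : Vec A n) where

  -- T[x] for 1 ≤ x ≤ n
  charAt : ℕ → Maybe A
  charAt zero    = nothing
  charAt (suc k) = T ! k

  ValidPhrase : ℕ → Phrase A → Set
  ValidPhrase s (chr c)   = charAt s ≡ just c
  ValidPhrase s (tgt t l) =
    1 ≤ l × 1 ≤ t × t ≢ s × t + l ∸ 1 ≤ n
    × (∀ k → k < l → charAt (t + k) ≡ charAt (s + k))

  -- phrases starting at position s partition T[s..m] for some m ≤ n
  IsPBPFrom : ℕ → List (Phrase A) → Set
  IsPBPFrom s []      = s ≤ suc n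
  IsPBPFrom s (f ∷ P) = ValidPhrase s f × IsPBPFrom (s + len f) P

  IsPBP : List (Phrase A) → Set
  IsPBP P = IsPBPFrom 1 P

  follow : List (Phrase A) → ℕ
  follow P = suc (sum (map len P))

  -- T[x] as a value of g⁰ (junk value inj₂ x only outside 1..n)
  charOr : ℕ → A ⊎ ℕ
  charOr x with charAt x
  ... | just c  = inj₁ c
  ... | nothing = inj₂ x

  g0From : ℕ → List (Phrase A) → ℕ → A ⊎ ℕ
  g0From s [] x = charOr x
  g0From s (chr c ∷ P) x with x ≟ s
  ... | yes _ = inj₁ c
  ... | no  _ = g0From (suc s) P x
  g0From s (tgt t l ∷ P) x with x <? s | x <? s + l
  ... | no _ | yes _ = inj₂ (t + (x ∸ s))
  ... | _    | _     = g0From (s + l) P x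

  g0 : List (Phrase A) → ℕ → A ⊎ ℕ
  g0 P = g0From 1 P

  g : List (Phrase A) → ℕ → ℕ → A ⊎ ℕ
  g P zero    x = g0 P x
  g P (suc k) x with g P k x
  ... | inj₁ c = inj₁ c
  ... | inj₂ y = g0 P y

  Valid : List (Phrase A) → Set
  Valid P = IsPBP P × (∀ x → 1 ≤ x → x ≤ n → IsChar (g P n x))

  Source : List (Phrase A) → ℕ → ℕ → Set
  Source P x y =
    (IsChar (g0 P x) × y ≡ x)
    ⊎ (∃[ k ] (g P k x ≡ inj₂ y × IsChar (g P (suc k) x)))

  -- x and y lie in the same class of 𝒟_P
  SameSource : List (Phrase A) → ℕ → ℕ → Set
  SameSource P x y = ∃[ z ] (Source P x z × Source P y z)

  -- P · ⟨j, ℓ⟩, with P · ⟨j, 0⟩ = P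
  extend : List (Phrase A) → ℕ → ℕ → List (Phrase A)
  extend P j zero    = P
  extend P j (suc l) = P ++ [ tgt j (suc l) ]

-- equivalence relation of the partition obtained from the partition with
-- relation R by merging the classes of a and b
Merge : (ℕ → ℕ → Set) → ℕ → ℕ → ℕ → ℕ → Set
Merge R a b x y = R x y ⊎ (R x a × R y b) ⊎ (R x b × R y a)

module _ {A : Set} (_≟A_ : DecidableEquality A) {n : ℕ} (T : Vec A n) where

  lcpFuel : ℕ → ℕ → ℕ → ℕ
  lcpFuel zero a b = 0
  lcpFuel (suc f) a b with charAt T a | charAt T b
  ... | just c | just d with c ≟A d
  ...   | yes _ = suc (lcpFuel f (suc a) (suc b))
  ...   | no  _ = 0
  lcpFuel (suc f) a b | _ | _ = 0

  lcp : ℕ → ℕ → ℕ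
  lcp a b = lcpFuel (suc n) a b

-- Read a parse as its pointer map g⁰ : ℕ → Σ ⊎ ℕ; then gᵏ x is the walk from x along the
-- pointers, stopped at the first character, and the source of x is the last position of that
-- walk.  Lengthening the last phrase from ⟨j,ℓ⟩ to ⟨j,ℓ+1⟩ changes g⁰ only at a = i+ℓ, which
-- held a character and now points to b = j+ℓ.  Walks that avoid a are unchanged, and a walk
-- through a continues as the walk from b.  If b already has source a, the walk from b now runs
-- in a cycle, so the parse is invalid.  Otherwise the walk from b is unchanged, so positions
-- with source a acquire the source of b while all other sources stay put: the classes of a and
-- b merge.  Validity asks for resolution within n steps, and a walk that resolves at all does
-- so before repeating one of the positions 1 … n (pigeonhole).
module Submission where

open import Defs
open import Data.Nat using (ℕ; zero; suc; _+_; _∸_; _≤_; _<_; _≟_; _<?_; z≤n; s≤s; s≤s⁻¹; z<s)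
open import Data.Nat.Properties
open import Data.Nat.GeneralisedArithmetic using (fold; fold-+)
open import Data.Nat.Induction using (<-rec)
open import Data.Fin using (Fin; toℕ; fromℕ<) renaming (_<_ to _<ᶠ_)
open import Data.Fin.Properties using (pigeonhole; toℕ<n; fromℕ<-injective)
open import Data.List using (List; []; _∷_; _++_; [_]; map)
open import Data.List.Properties using (++-identityʳ)
open import Data.Nat.ListAction using (sum)
open import Data.Vec using (Vec; []; _∷_)
open import Data.Maybe using (just; nothing)
open import Data.Sum using (_⊎_; inj₁; inj₂; [_,_]′)
open import Data.Sum.Properties using (inj₂-injective)
open import Data.Sum.Function.Propositional using (_⊎-⇔_)
open import Data.Product using (_×_; _,_; ∃; ∃₂; ∃-syntax; proj₁; proj₂)
open import Data.Product.Function.NonDependent.Propositional using (_×-⇔_)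
open import Data.Empty using (⊥-elim)
open import Function using (_∘_; const; id)
open import Function.Bundles using (_⇔_; mk⇔; Equivalence)
open import Function.Construct.Composition using (_⇔-∘_)
open import Function.Construct.Symmetry using (⇔-sym)
open import Relation.Nullary using (¬_; Dec; yes; no)
open import Relation.Binary.PropositionalEquality using (_≡_; _≢_; refl; sym; trans; cong; subst)
open import Relation.Binary.Definitions using (DecidableEquality; tri<; tri≈; tri>)

module _ {A : Set} where

  ¬IsChar-inj₂ : ∀ {y} → ¬ IsChar {A} (inj₂ y)
  ¬IsChar-inj₂ (_ , ())

  isChar? : (v : A ⊎ ℕ) → Dec (IsChar v)
  isChar? (inj₁ c) = yes (c , refl)
  isChar? (inj₂ _) = no ¬IsChar-inj₂

  position : A ⊎ ℕ → ℕ
  position = [ const 0 , id ]′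

  unresolved-position : ∀ {v} → ¬ IsChar v → v ≡ inj₂ (position v)
  unresolved-position {inj₁ c} ¬char = ⊥-elim (¬char (c , refl))
  unresolved-position {inj₂ _} _     = refl

module _ {A : Set} (f : ℕ → A ⊎ ℕ) where

  jump : A ⊎ ℕ → A ⊎ ℕ
  jump = [ inj₁ , f ]′

  walk : ℕ → A ⊎ ℕ → A ⊎ ℕ
  walk k v = fold v jump k

  walk-+ : ∀ m k v → walk (m + k) v ≡ walk m (walk k v)
  walk-+ m k v = fold-+ v jump m

  walk-split : ∀ {m k} v → m ≤ k → walk k v ≡ walk (k ∸ m) (walk m v)
  walk-split {m} {k} v m≤k = trans (cong (λ t → walk t v) (sym (m∸n+n≡m m≤k))) (walk-+ (k ∸ m) m v)

  walk-inj₁ : ∀ k c → walk k (inj₁ c) ≡ inj₁ c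
  walk-inj₁ zero    c = refl
  walk-inj₁ (suc k) c = cong jump (walk-inj₁ k c)

  walk-fixed : ∀ {y} → f y ≡ inj₂ y → ∀ k → walk k (inj₂ y) ≡ inj₂ y
  walk-fixed fy zero    = refl
  walk-fixed fy (suc k) = trans (cong jump (walk-fixed fy k)) fy

  walk-resolved-≤ : ∀ {m k v} → m ≤ k → IsChar (walk m v) → IsChar (walk k v)
  walk-resolved-≤ {m} {k} {v} m≤k (c , e) =
    c , trans (walk-split v m≤k) (trans (cong (walk (k ∸ m)) e) (walk-inj₁ (k ∸ m) c))

  walk-resolves-after : ∀ {k m v y} → walk k v ≡ inj₂ y → IsChar (f y) → k < m → IsChar (walk m v)
  walk-resolves-after e fy k<m = walk-resolved-≤ k<m (subst (IsChar ∘ jump) (sym e) fy)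

  walk-shortcut : ∀ {p q k v} → walk p v ≡ walk q v → q ≤ k → walk (k ∸ q + p) v ≡ walk k v
  walk-shortcut {p} {q} {k} {v} loop q≤k =
    trans (walk-+ (k ∸ q) p v) (trans (cong (walk (k ∸ q)) loop) (sym (walk-split v q≤k)))

  Src : ℕ → ℕ → Set
  Src x y = ∃[ k ] walk k (inj₂ x) ≡ inj₂ y × IsChar (f y)

  SameSrc : ℕ → ℕ → Set
  SameSrc x y = ∃[ z ] Src x z × Src y z

  HasSrc : ℕ → Set
  HasSrc x = ∃ (Src x)

  src-unique : ∀ {x y y′} → Src x y → Src x y′ → y ≡ y′
  src-unique (k , e , fy) (k′ , e′ , fy′) with <-cmp k k′
  ... | tri< k<k′ _ _ = ⊥-elim (¬IsChar-inj₂ (subst IsChar e′ (walk-resolves-after e fy k<k′)))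
  ... | tri≈ _ refl _ = inj₂-injective (trans (sym e) e′)
  ... | tri> _ _ k′<k = ⊥-elim (¬IsChar-inj₂ (subst IsChar e (walk-resolves-after e′ fy′ k′<k)))

  resolved⇒hasSrc : ∀ k {x} → IsChar (walk k (inj₂ x)) → HasSrc x
  resolved⇒hasSrc zero    char = ⊥-elim (¬IsChar-inj₂ char)
  resolved⇒hasSrc (suc k) {x} char with walk k (inj₂ x) in e
  ... | inj₁ c = resolved⇒hasSrc k (c , e)
  ... | inj₂ y = y , k , e , char

  hasSrc⇒resolved : ∀ {x} → HasSrc x → ∃[ k ] IsChar (walk k (inj₂ x))
  hasSrc⇒resolved (_ , k , e , fy) = suc k , subst (IsChar ∘ jump) (sym e) fy

module _ {A : Set} {n : ℕ} (f : ℕ → A ⊎ ℕ) (fixed : ∀ y → n < y → f y ≡ inj₂ y) where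

  resolving-walk-position-≤ : ∀ {m k v p} → IsChar (walk f k v) → m ≤ k →
                              walk f m v ≡ inj₂ p → p ≤ n
  resolving-walk-position-≤ {m} {k} {v} {p} char m≤k e = ≮⇒≥ λ n<p →
    ¬IsChar-inj₂ (subst IsChar (trans (walk-split f v m≤k)
                                  (trans (cong (walk f (k ∸ m)) e) (walk-fixed f (fixed p n<p) (k ∸ m))))
                           char)

  -- pigeonhole on the positions visited in steps 0 … n + 1, all among 0 … n
  walk-repeats : ∀ {k v} → ¬ IsChar (walk f (suc n) v) → IsChar (walk f k v) →
                 ∃₂ λ p q → p < q × q ≤ k × walk f p v ≡ walk f q v
  walk-repeats {k} {v} ¬char char = repetition (pigeonhole (n<1+n (suc n)) slot)
    where
    bound : (i : Fin (suc (suc n))) → toℕ i ≤ suc n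
    bound i = s≤s⁻¹ (toℕ<n i)
    unresolved : ∀ {m} → m ≤ suc n → walk f m v ≡ inj₂ (position (walk f m v))
    unresolved m≤ = unresolved-position (¬char ∘ walk-resolved-≤ f m≤)
    suc-n≤k : suc n ≤ k
    suc-n≤k = ≮⇒≥ λ k<sn → ¬char (walk-resolved-≤ f (<⇒≤ k<sn) char)
    slot : Fin (suc (suc n)) → Fin (suc n)
    slot i = fromℕ< (s≤s (resolving-walk-position-≤ char (≤-trans (bound i) suc-n≤k)
                                                          (unresolved (bound i))))
    repetition : ∃₂ (λ i i′ → i <ᶠ i′ × slot i ≡ slot i′) →
                 ∃₂ λ p q → p < q × q ≤ k × walk f p v ≡ walk f q v
    repetition (i , i′ , i<i′ , same) =
      toℕ i , toℕ i′ , i<i′ , ≤-trans (bound i′) suc-n≤k , trans (unresolved (bound i))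
        (trans (cong inj₂ (fromℕ<-injective _ _ _ _ same)) (sym (unresolved (bound i′))))

  ResolvesWithin : ℕ → Set
  ResolvesWithin k = ∀ {v} → IsChar (walk f k v) → IsChar (walk f (suc n) v)

  walk-resolves-within : ∀ k → ResolvesWithin k
  walk-resolves-within = <-rec ResolvesWithin shorten
    where
    shorten : ∀ k → (∀ {k′} → k′ < k → ResolvesWithin k′) → ResolvesWithin k
    shorten k rec {v} char with isChar? (walk f (suc n) v)
    ... | yes done  = done
    ... | no ¬char = cut (walk-repeats ¬char char)
      where
      cut : (∃₂ λ p q → p < q × q ≤ k × walk f p v ≡ walk f q v) → IsChar (walk f (suc n) v)
      cut (p , q , p<q , q≤k , loop) =
        rec (subst (k ∸ q + p <_) (m∸n+n≡m q≤k) (+-monoʳ-< (k ∸ q) p<q))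
            (subst IsChar (sym (walk-shortcut f loop q≤k)) char)

module Redirect {A : Set} (f f′ : ℕ → A ⊎ ℕ) (a b : ℕ) (a-resolved : IsChar (f a))
                (f′-a : f′ a ≡ inj₂ b) (f′-agrees : ∀ x → x ≢ a → f′ x ≡ f x) where

  -- a walk that is still unresolved never passed through the resolved position a
  walk-redirect : ∀ k {v z} → walk f k v ≡ inj₂ z → walk f′ k v ≡ inj₂ z
  walk-redirect zero        e = e
  walk-redirect (suc k) {v} e with walk f k v in e₀
  ... | inj₂ y = trans (cong (jump f′) (walk-redirect k e₀)) (trans (f′-agrees y y≢a) e)
    where
    y≢a : y ≢ a
    y≢a refl = ¬IsChar-inj₂ (subst IsChar e a-resolved)

  walk-via-a : ∀ m {x} → walk f m (inj₂ x) ≡ inj₂ a →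
               ∀ k → walk f′ (k + suc m) (inj₂ x) ≡ walk f′ k (inj₂ b)
  walk-via-a m {x} e k =
    trans (walk-+ f′ k (suc m) (inj₂ x))
          (cong (walk f′ k) (trans (cong (jump f′) (walk-redirect m e)) f′-a))

  src-a : Src f a a
  src-a = 0 , refl , a-resolved

  src-redirect : ∀ {x z} → Src f x z → z ≢ a → Src f′ x z
  src-redirect (k , e , fz) z≢a = k , walk-redirect k e , subst IsChar (sym (f′-agrees _ z≢a)) fz

  src-via-a : ∀ {x z} → Src f x a → Src f′ b z → Src f′ x z
  src-via-a (m , e , _) (k , e′ , f′z) = k + suc m , trans (walk-via-a m e k) e′ , f′z

  -- the f′-walk from b reaches a and then returns to b, so it is unresolved at arbitrarily late steps
  sameSrc⇒¬hasSrc : SameSrc f a b → ¬ HasSrc f′ b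
  sameSrc⇒¬hasSrc (z , sa , sb) (w , k , e , f′w) with src-unique f src-a sa
  ... | refl with m , e₀ , _ ← sb =
    ¬IsChar-inj₂ (subst IsChar (trans (walk-via-a m e₀ k) e)
                               (walk-resolves-after f′ {k} e f′w (m<m+n k z<s)))

  module _ (a≁b : ¬ SameSrc f a b) where

    src-b-≢a : ∀ {w} → Src f b w → w ≢ a
    src-b-≢a sb refl = a≁b (a , src-a , sb)

    src′-of-a-class : ∀ {x w} → Src f x a → Src f b w → Src f′ x w
    src′-of-a-class sx sb = src-via-a sx (src-redirect sb (src-b-≢a sb))

    src′-of-b-class : ∀ {x w} → Src f x w → Src f b w → Src f′ x w
    src′-of-b-class sx sb = src-redirect sx (src-b-≢a sb)

    hasSrc-redirect : HasSrc f b → ∀ {x} → HasSrc f x → HasSrc f′ x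
    hasSrc-redirect (w , sb) (z , sx) with z ≟ a
    ... | no z≢a  = z , src-redirect sx z≢a
    ... | yes refl = w , src′-of-a-class sx sb

    src-redirect⁻¹ : ∀ {x z w} → Src f b w → HasSrc f x → Src f′ x z →
                     (Src f x z × z ≢ a) ⊎ (Src f x a × Src f b z)
    src-redirect⁻¹ sb (y , sx) s′x with y ≟ a
    ... | no y≢a with refl ← src-unique f′ (src-redirect sx y≢a) s′x = inj₁ (sx , y≢a)
    ... | yes refl with refl ← src-unique f′ (src′-of-a-class sx sb) s′x = inj₂ (sx , sb)

    sameSrc-redirect : HasSrc f b → ∀ {x y} → HasSrc f x → HasSrc f y →
                       SameSrc f′ x y ⇔ Merge (SameSrc f) a b x y
    sameSrc-redirect (w , sb) {x} {y} hx hy = mk⇔ to from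
      where
      to : SameSrc f′ x y → Merge (SameSrc f) a b x y
      to (z , s′x , s′y) with src-redirect⁻¹ sb hx s′x | src-redirect⁻¹ sb hy s′y
      ... | inj₁ (sx , _)    | inj₁ (sy , _)    = inj₁ (z , sx , sy)
      ... | inj₁ (sx , _)    | inj₂ (sya , sbz) = inj₂ (inj₂ ((z , sx , sbz) , (a , sya , src-a)))
      ... | inj₂ (sxa , sbz) | inj₁ (sy , _)    = inj₂ (inj₁ ((a , sxa , src-a) , (z , sy , sbz)))
      ... | inj₂ (sxa , _)   | inj₂ (sya , _)   = inj₁ (a , sxa , sya)
      from : Merge (SameSrc f) a b x y → SameSrc f′ x y
      from (inj₁ (z , sx , sy)) with z ≟ a
      ... | no z≢a  = z , src-redirect sx z≢a , src-redirect sy z≢a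
      ... | yes refl = w , src′-of-a-class sx sb , src′-of-a-class sy sb
      from (inj₂ (inj₁ ((z , sx , sa) , (w′ , sy , sb′)))) with refl ← src-unique f src-a sa =
        w′ , src′-of-a-class sx sb′ , src′-of-b-class sy sb′
      from (inj₂ (inj₂ ((w′ , sx , sb′) , (z , sy , sa)))) with refl ← src-unique f src-a sa =
        w′ , src′-of-b-class sx sb′ , src′-of-a-class sy sb′

Merge-cong : ∀ {R S : ℕ → ℕ → Set} → (∀ x y → R x y ⇔ S x y) →
             ∀ a b x y → Merge R a b x y ⇔ Merge S a b x y
Merge-cong R⇔S a b x y = R⇔S x y ⊎-⇔ (R⇔S x a ×-⇔ R⇔S y b) ⊎-⇔ (R⇔S x b ×-⇔ R⇔S y a)

module _ {A : Set} {n : ℕ} (T : Vec A n) (P : List (Phrase A)) where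

  g-suc : ∀ k x → g T P (suc k) x ≡ jump (g0 T P) (g T P k x)
  g-suc k x with g T P k x
  ... | inj₁ _ = refl
  ... | inj₂ _ = refl

  g≡walk : ∀ k x → g T P k x ≡ walk (g0 T P) (suc k) (inj₂ x)
  g≡walk zero    x = refl
  g≡walk (suc k) x = trans (g-suc k x) (cong (jump (g0 T P)) (g≡walk k x))

  source⇔src : ∀ x y → Source T P x y ⇔ Src (g0 T P) x y
  source⇔src x y = mk⇔ to from
    where
    to : Source T P x y → Src (g0 T P) x y
    to (inj₁ (char , refl))   = 0 , refl , char
    to (inj₂ (k , e , char)) =
      suc k , trans (sym (g≡walk k x)) e , subst IsChar (trans (g-suc k x) (cong (jump (g0 T P)) e)) char
    from : Src (g0 T P) x y → Source T P x y
    from (zero  , refl , char) = inj₁ (char , refl)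
    from (suc k , e , char)    =
      inj₂ (k , e′ , subst IsChar (sym (trans (g-suc k x) (cong (jump (g0 T P)) e′))) char)
      where
      e′ : g T P k x ≡ inj₂ y
      e′ = trans (g≡walk k x) e

  sameSource⇔sameSrc : ∀ x y → SameSource T P x y ⇔ SameSrc (g0 T P) x y
  sameSource⇔sameSrc x y = mk⇔
    (λ (z , sx , sy) → z , Equivalence.to (source⇔src x z) sx , Equivalence.to (source⇔src y z) sy)
    (λ (z , sx , sy) → z , Equivalence.from (source⇔src x z) sx , Equivalence.from (source⇔src y z) sy)

  valid⇒hasSrc : Valid T P → ∀ {x} → 1 ≤ x → x ≤ n → HasSrc (g0 T P) x
  valid⇒hasSrc (_ , resolved) {x} 1≤x x≤n =
    resolved⇒hasSrc (g0 T P) (suc n) (subst IsChar (g≡walk n x) (resolved x 1≤x x≤n))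

  hasSrc⇒valid : IsPBP T P → (∀ y → n < y → g0 T P y ≡ inj₂ y) →
                 (∀ {x} → 1 ≤ x → x ≤ n → HasSrc (g0 T P) x) → Valid T P
  hasSrc⇒valid isPBP fixed hasSrc = isPBP , λ x 1≤x x≤n →
    let k , resolved = hasSrc⇒resolved (g0 T P) (hasSrc 1≤x x≤n)
    in subst IsChar (sym (g≡walk n x)) (walk-resolves-within (g0 T P) fixed k resolved)

module _ {A : Set} {n : ℕ} (T : Vec A n) where

  charAt-beyond : ∀ y → n < y → charAt T y ≡ nothing
  charAt-beyond (suc k) n<y = lookup-beyond T (s≤s⁻¹ n<y)
    where
    lookup-beyond : ∀ {m k} (V : Vec A m) → m ≤ k → V ! k ≡ nothing
    lookup-beyond []                  _         = refl
    lookup-beyond {k = suc k} (_ ∷ V) (s≤s m≤k) = lookup-beyond V m≤k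

  charAt-inRange : ∀ x {c} → charAt T x ≡ just c → 1 ≤ x × x ≤ n
  charAt-inRange (suc k) e = s≤s z≤n , lookup-inRange T e
    where
    lookup-inRange : ∀ {m k c} (V : Vec A m) → V ! k ≡ just c → suc k ≤ m
    lookup-inRange {k = zero}  (_ ∷ V) _ = s≤s z≤n
    lookup-inRange {k = suc k} (_ ∷ V) e = s≤s (lookup-inRange V e)

  charOr-just : ∀ x {c} → charAt T x ≡ just c → charOr T x ≡ inj₁ c
  charOr-just x e with charAt T x
  charOr-just x refl | just _ = refl

  charOr-beyond : ∀ y → n < y → charOr T y ≡ inj₂ y
  charOr-beyond y n<y with charAt T y | charAt-beyond y n<y
  ... | nothing | _ = refl

  parsedLength : List (Phrase A) → ℕ
  parsedLength P = sum (map len P)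

  isPBPFrom-++ : ∀ s P {R} → IsPBPFrom T s P → IsPBPFrom T (s + parsedLength P) R → IsPBPFrom T s (P ++ R)
  isPBPFrom-++ s []      {R} _            isPBP-R = subst (λ t → IsPBPFrom T t R) (+-identityʳ s) isPBP-R
  isPBPFrom-++ s (f ∷ P) {R} (f-ok , P-ok) isPBP-R =
    f-ok , isPBPFrom-++ (s + len f) P P-ok
                        (subst (λ t → IsPBPFrom T t R) (sym (+-assoc s (len f) (parsedLength P))) isPBP-R)

  g0From-below : ∀ s R x → x < s → g0From T s R x ≡ charOr T x
  g0From-below s []            x _   = refl
  g0From-below s (chr c ∷ R)   x x<s with x ≟ s
  ... | yes refl = ⊥-elim (<-irrefl refl x<s)
  ... | no _     = g0From-below (suc s) R x (m<n⇒m<1+n x<s)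
  g0From-below s (tgt t l ∷ R) x x<s with x <? s | x <? s + l
  ... | yes _  | _ = g0From-below (s + l) R x (≤-trans x<s (m≤m+n s l))
  ... | no x≮s | _ = ⊥-elim (x≮s x<s)

  g0From-++ˡ : ∀ s P R x → x < s + parsedLength P → g0From T s (P ++ R) x ≡ g0From T s P x
  g0From-++ˡ s []            R x x<s = g0From-below s R x (subst (x <_) (+-identityʳ s) x<s)
  g0From-++ˡ s (chr c ∷ P)   R x x<  with x ≟ s
  ... | yes _ = refl
  ... | no _  = g0From-++ˡ (suc s) P R x (subst (x <_) (+-suc s (parsedLength P)) x<)
  g0From-++ˡ s (tgt t l ∷ P) R x x<  with x <? s | x <? s + l
  ... | yes _ | _     = g0From-++ˡ (s + l) P R x (subst (x <_) (sym (+-assoc s l (parsedLength P))) x<)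
  ... | no _  | yes _ = refl
  ... | no _  | no _  = g0From-++ˡ (s + l) P R x (subst (x <_) (sym (+-assoc s l (parsedLength P))) x<)

  g0From-++ʳ : ∀ s P R x → s + parsedLength P ≤ x →
               g0From T s (P ++ R) x ≡ g0From T (s + parsedLength P) R x
  g0From-++ʳ s []            R x _  = cong (λ t → g0From T t R x) (sym (+-identityʳ s))
  g0From-++ʳ s (chr c ∷ P)   R x ≤x with x ≟ s
  ... | yes refl = ⊥-elim (m+1+n≰m x ≤x)
  ... | no _     = trans (g0From-++ʳ (suc s) P R x (subst (_≤ x) (+-suc s (parsedLength P)) ≤x))
                         (cong (λ t → g0From T t R x) (sym (+-suc s (parsedLength P))))
  g0From-++ʳ s (tgt t l ∷ P) R x ≤x with x <? s | x <? s + l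
  ... | yes x<s | _      = ⊥-elim (<⇒≱ x<s (≤-trans (m≤m+n s _) ≤x))
  ... | no _    | yes x< = ⊥-elim (<⇒≱ x< (≤-trans (+-monoʳ-≤ s (m≤m+n l _)) ≤x))
  ... | no _    | no _   =
    trans (g0From-++ʳ (s + l) P R x (subst (_≤ x) (sym (+-assoc s l (parsedLength P))) ≤x))
          (cong (λ t → g0From T t R x) (+-assoc s l (parsedLength P)))

  g0From-beyond : ∀ s P x → s + parsedLength P ≤ x → g0From T s P x ≡ charOr T x
  g0From-beyond s P x ≤x =
    subst (λ Q → g0From T s Q x ≡ charOr T x) (++-identityʳ P) (g0From-++ʳ s P [] x ≤x)

  g0From-tgt-∈ : ∀ s t l x → s ≤ x → x < s + l → g0From T s [ tgt t l ] x ≡ inj₂ (t + (x ∸ s))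
  g0From-tgt-∈ s t l x s≤x x< with x <? s | x <? s + l
  ... | no _    | yes _ = refl
  ... | yes x<s | _     = ⊥-elim (<⇒≱ x<s s≤x)
  ... | no _    | no x≮ = ⊥-elim (x≮ x<)

  g0From-tgt-≥ : ∀ s t l x → s + l ≤ x → g0From T s [ tgt t l ] x ≡ charOr T x
  g0From-tgt-≥ s t l x ≤x with x <? s | x <? s + l
  ... | yes _ | _     = refl
  ... | no _  | no _  = refl
  ... | no _  | yes x< = ⊥-elim (<⇒≱ x< ≤x)

module _ {A : Set} {n : ℕ} (T : Vec A n) (P : List (Phrase A)) (j : ℕ) where

  private
    i = follow T P

  g0-extend-< : ∀ L x → x < i → g0 T (extend T P j L) x ≡ g0 T P x
  g0-extend-< zero    x _   = refl
  g0-extend-< (suc L) x x<i = g0From-++ˡ T 1 P _ x x<i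

  g0-extend-∈ : ∀ L x → i ≤ x → x < i + L → g0 T (extend T P j L) x ≡ inj₂ (j + (x ∸ i))
  g0-extend-∈ zero    x i≤x x< = ⊥-elim (<⇒≱ x< (subst (_≤ x) (sym (+-identityʳ _)) i≤x))
  g0-extend-∈ (suc L) x i≤x x< =
    trans (g0From-++ʳ T 1 P _ x i≤x) (g0From-tgt-∈ T i j (suc L) x i≤x x<)

  g0-extend-≥ : ∀ L x → i + L ≤ x → g0 T (extend T P j L) x ≡ charOr T x
  g0-extend-≥ zero    x ≤x = g0From-beyond T 1 P x (subst (_≤ x) (+-identityʳ _) ≤x)
  g0-extend-≥ (suc L) x ≤x =
    trans (g0From-++ʳ T 1 P _ x (≤-trans (m≤m+n _ (suc L)) ≤x)) (g0From-tgt-≥ T i j (suc L) x ≤x)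

  g0-extend-resolved : ∀ ℓ {c} → charAt T (i + ℓ) ≡ just c → IsChar (g0 T (extend T P j ℓ) (i + ℓ))
  g0-extend-resolved ℓ {c} e = c , trans (g0-extend-≥ ℓ _ ≤-refl) (charOr-just T _ e)

  g0-extend-suc-redirects : ∀ ℓ → g0 T (extend T P j (suc ℓ)) (i + ℓ) ≡ inj₂ (j + ℓ)
  g0-extend-suc-redirects ℓ =
    trans (g0-extend-∈ (suc ℓ) _ (m≤m+n _ ℓ) (+-monoʳ-< (i) (n<1+n ℓ)))
          (cong (λ d → inj₂ (j + d)) (m+n∸m≡n (i) ℓ))

  g0-extend-suc-agrees : ∀ ℓ x → x ≢ i + ℓ →
                         g0 T (extend T P j (suc ℓ)) x ≡ g0 T (extend T P j ℓ) x
  g0-extend-suc-agrees ℓ x x≢ with x <? i | x <? i + ℓ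
  ... | yes x<i | _      = trans (g0-extend-< (suc ℓ) x x<i) (sym (g0-extend-< ℓ x x<i))
  ... | no x≮i  | yes x< =
    trans (g0-extend-∈ (suc ℓ) x (≮⇒≥ x≮i) (<-≤-trans x< (+-monoʳ-≤ (i) (n≤1+n ℓ))))
          (sym (g0-extend-∈ ℓ x (≮⇒≥ x≮i) x<))
  ... | no _    | no x≮  =
    trans (g0-extend-≥ (suc ℓ) x (subst (_≤ x) (sym (+-suc _ ℓ)) (≤∧≢⇒< (≮⇒≥ x≮) (x≢ ∘ sym))))
          (sym (g0-extend-≥ ℓ x (≮⇒≥ x≮)))

  g0-extend-beyond : ∀ L → i + L ≤ suc n → ∀ y → n < y → g0 T (extend T P j L) y ≡ inj₂ y
  g0-extend-beyond L ≤sn y n<y = trans (g0-extend-≥ L y (≤-trans ≤sn n<y)) (charOr-beyond T y n<y)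

  isPBP-extend : ∀ L → IsPBP T P → ValidPhrase T (i) (tgt j (suc L)) → i + suc L ≤ suc n →
                 IsPBP T (extend T P j (suc L))
  isPBP-extend L isPBP-P phrase-ok ≤sn = isPBPFrom-++ T 1 P isPBP-P (phrase-ok , ≤sn)

module _ {A : Set} (_≟A_ : DecidableEquality A) {n : ℕ} (T : Vec A n) where

  lcpFuel-common : ∀ fuel a b k → k < lcpFuel _≟A_ T fuel a b →
                   ∃[ c ] charAt T (a + k) ≡ just c × charAt T (b + k) ≡ just c
  lcpFuel-common (suc fuel) a b k k< with charAt T a in ea | charAt T b in eb
  ... | just c | just d with c ≟A d
  ...   | yes refl = common k k<
    where
    common : ∀ k → k < suc (lcpFuel _≟A_ T fuel (suc a) (suc b)) →
             ∃[ c ] charAt T (a + k) ≡ just c × charAt T (b + k) ≡ just c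
    common zero    _        =
      c , trans (cong (charAt T) (+-identityʳ a)) ea , trans (cong (charAt T) (+-identityʳ b)) eb
    common (suc k) (s≤s k<) =
      let c′ , ea′ , eb′ = lcpFuel-common fuel (suc a) (suc b) k k<
      in c′ , trans (cong (charAt T) (+-suc a k)) ea′ , trans (cong (charAt T) (+-suc b k)) eb′

  lcp-common : ∀ {a b k} → k < lcp _≟A_ T a b →
               ∃[ c ] charAt T (a + k) ≡ just c × charAt T (b + k) ≡ just c
  lcp-common {a} {b} {k} = lcpFuel-common (suc n) a b k

module ExtendByOne {A : Set} (_≟A_ : DecidableEquality A) {n : ℕ} (T : Vec A n)
                   (P : List (Phrase A)) (j ℓ : ℕ)
                   (ℓ<lcp : ℓ < lcp _≟A_ T (follow T P) j) (valid-Q : Valid T (extend T P j ℓ)) where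

  private
    i = follow T P
    Q = extend T P j ℓ
    Q′ = extend T P j (suc ℓ)

    common : ∀ k → k ≤ ℓ → ∃[ c ] charAt T (i + k) ≡ just c × charAt T (j + k) ≡ just c
    common k k≤ℓ = lcp-common _≟A_ T (≤-<-trans k≤ℓ ℓ<lcp)

    i+ℓ↦c = proj₁ (proj₂ (common ℓ ≤-refl))
    j+ℓ↦c = proj₂ (proj₂ (common ℓ ≤-refl))

    1≤j+ℓ = proj₁ (charAt-inRange T (j + ℓ) j+ℓ↦c)
    j+ℓ≤n = proj₂ (charAt-inRange T (j + ℓ) j+ℓ↦c)

    i+1+ℓ≤1+n : i + suc ℓ ≤ suc n
    i+1+ℓ≤1+n = subst (_≤ suc n) (sym (+-suc i ℓ)) (s≤s (proj₂ (charAt-inRange T (i + ℓ) i+ℓ↦c)))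

    hasSrc-Q : ∀ {x} → 1 ≤ x → x ≤ n → HasSrc (g0 T Q) x
    hasSrc-Q = valid⇒hasSrc T Q valid-Q

    sameSrc⇒sameSource : ∀ {x y} → SameSrc (g0 T Q) x y → SameSource T Q x y
    sameSrc⇒sameSource = Equivalence.from (sameSource⇔sameSrc T Q _ _)

  open Redirect (g0 T Q) (g0 T Q′) (i + ℓ) (j + ℓ)
    (g0-extend-resolved T P j ℓ i+ℓ↦c) (g0-extend-suc-redirects T P j ℓ) (g0-extend-suc-agrees T P j ℓ)

  extension-invalid : SameSource T Q (i + ℓ) (j + ℓ) → ¬ Valid T Q′
  extension-invalid a~b valid-Q′ =
    sameSrc⇒¬hasSrc (Equivalence.to (sameSource⇔sameSrc T Q _ _) a~b)
                    (valid⇒hasSrc T Q′ valid-Q′ 1≤j+ℓ j+ℓ≤n)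

  extension-valid : IsPBP T P → 1 ≤ j → ¬ SameSource T Q (i + ℓ) (j + ℓ) → Valid T Q′
  extension-valid isPBP-P 1≤j a≁b =
    hasSrc⇒valid T Q′ (isPBP-extend T P j ℓ isPBP-P phrase-ok i+1+ℓ≤1+n)
                      (g0-extend-beyond T P j (suc ℓ) i+1+ℓ≤1+n)
      (λ 1≤x x≤n → hasSrc-redirect (a≁b ∘ sameSrc⇒sameSource)
                                   (hasSrc-Q 1≤j+ℓ j+ℓ≤n) (hasSrc-Q 1≤x x≤n))
    where
    j≢i : j ≢ i
    j≢i refl = a≁b (sameSrc⇒sameSource (i + ℓ , src-a , src-a))
    phrase-ok : ValidPhrase T i (tgt j (suc ℓ))
    phrase-ok = s≤s z≤n , 1≤j , j≢i , subst (λ m → m ∸ 1 ≤ n) (sym (+-suc j ℓ)) j+ℓ≤n ,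
                λ k k<1+ℓ → let _ , i+k↦ , j+k↦ = common k (s≤s⁻¹ k<1+ℓ) in trans j+k↦ (sym i+k↦)

  extension-classes : Valid T Q′ → ∀ x y → 1 ≤ x → x ≤ n → 1 ≤ y → y ≤ n →
                      SameSource T Q′ x y ⇔ Merge (SameSource T Q) (i + ℓ) (j + ℓ) x y
  extension-classes valid-Q′ x y 1≤x x≤n 1≤y y≤n =
    ⇔-sym (Merge-cong (sameSource⇔sameSrc T Q) _ _ x y)
    ⇔-∘ (sameSrc-redirect (λ a~b → extension-invalid (sameSrc⇒sameSource a~b) valid-Q′)
           (hasSrc-Q 1≤j+ℓ j+ℓ≤n) (hasSrc-Q 1≤x x≤n) (hasSrc-Q 1≤y y≤n)
    ⇔-∘ sameSource⇔sameSrc T Q′ x y)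

corollary1 : {A : Set} (_≟A_ : DecidableEquality A) {n : ℕ} (T : Vec A n)
    (P : List (Phrase A)) (j ℓ : ℕ) →
    Valid T P → 1 ≤ j → j ≤ n → ℓ < lcp _≟A_ T (follow T P) j →
    Valid T (extend T P j ℓ) →
    ((¬ SameSource T (extend T P j ℓ) (follow T P + ℓ) (j + ℓ) → Valid T (extend T P j (suc ℓ)))
     × (SameSource T (extend T P j ℓ) (follow T P + ℓ) (j + ℓ) → ¬ Valid T (extend T P j (suc ℓ))))
    × (Valid T (extend T P j (suc ℓ)) →
       ∀ x y → 1 ≤ x → x ≤ n → 1 ≤ y → y ≤ n →
       SameSource T (extend T P j (suc ℓ)) x y
         ⇔ Merge (SameSource T (extend T P j ℓ)) (follow T P + ℓ) (j + ℓ) x y)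
corollary1 _≟A_ T P j ℓ (isPBP-P , _) 1≤j _ ℓ<lcp valid-Q =
  (extension-valid isPBP-P 1≤j , extension-invalid) , extension-classes
  where
  open ExtendByOne _≟A_ T P j ℓ ℓ<lcp valid-Q
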